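{- Let $s,t$ be variable disjoint expressions with $t$ linear, and let $S$ be a set of variables with $S\cap Var(t)=\emptyset$. If $s$ and $t$ are unifiable, then there exists a relevant mgu $\theta$ of $s$ and $t$ such that $\theta$ is linear for $S$ and $Ran(\theta|s)\subseteq Var(t)$.
   Context: An expression is a term, an atom, or a tuple of terms or atoms; it is linear if no variable occurs in it more than once; $Var(u)$ is its set of variables. For a substitution $\theta=\{X_1/t_1,\ldots,X_n/t_n\}$: $Dom(\theta)=\{X_1,\ldots,X_n\}$, $Ran(\theta)=Var(t_1,\ldots,t_n)$, $Var(\theta)=Dom(\theta)\cup Ran(\theta)$, and for an expression $u$, $\theta|u=\{X/t\in\theta\mid X\in Var(u)\}$. An mgu $\theta$ of $s,t$ is relevant if $Var(\theta)\subseteq Var(s,t)$. A substitution $\theta$ is linear for a set $S$ of variables if for any two distinct $X,Y\in S$ the pair $X\theta,Y\theta$ is linear, and $X\theta$ is linear when $S=\{X\}$. -}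

module Defs where

open import Data.Nat using (ℕ; _≟_)
open import Data.List using (List; []; _∷_; _++_; map; concatMap; filter)
open import Data.Product using (_×_; _,_; proj₁; proj₂; Σ; ∃)
open import Data.List.Membership.Propositional using (_∈_; _∉_)
open import Data.List.Membership.DecPropositional _≟_ using (_∈?_)
open import Data.List.Relation.Unary.All using (All)
open import Data.List.Relation.Unary.Unique.Propositional using (Unique)
open import Relation.Binary.PropositionalEquality using (_≡_; _≢_)
open import Relation.Nullary using (¬_; yes; no)

-- Atoms p(t1,...,tn) and tuples (u1,...,un) are represented as
-- terms headed by a (predicate resp. tuple) symbol, so an "expression" is a Term.
Var : Set
Var = ℕ

data Term : Set where
  var : Var → Term
  fn  : ℕ → List Term → Term

Expr : Set
Expr = Term

mutual
  vars : Term → List Var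
  vars (var x)   = x ∷ []
  vars (fn f ts) = varsL ts

  varsL : List Term → List Var
  varsL []       = []
  varsL (t ∷ ts) = vars t ++ varsL ts

Linear : Expr → Set
Linear u = Unique (vars u)

LinearPair : Expr → Expr → Set
LinearPair u v = Unique (vars u ++ vars v)

Binding : Set
Binding = Var × Term

record Subst : Set where
  constructor mkSubst
  field
    bindings : List Binding
    distinct : Unique (map proj₁ bindings)
    nontriv  : All (λ b → proj₂ b ≢ var (proj₁ b)) bindings
open Subst public

lookupB : List Binding → Var → Term
lookupB []            x = var x
lookupB ((y , t) ∷ bs) x with x ≟ y
... | yes _ = t
... | no  _ = lookupB bs x

mutual
  applyB : List Binding → Term → Term
  applyB bs (var x)   = lookupB bs x
  applyB bs (fn f ts) = fn f (applyBL bs ts)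

  applyBL : List Binding → List Term → List Term
  applyBL bs []       = []
  applyBL bs (t ∷ ts) = applyB bs t ∷ applyBL bs ts

_·_ : Term → Subst → Term
u · θ = applyB (bindings θ) u

DomB : List Binding → List Var
DomB = map proj₁

RanB : List Binding → List Var
RanB = concatMap (λ b → vars (proj₂ b))

Dom : Subst → List Var
Dom θ = DomB (bindings θ)

Ran : Subst → List Var
Ran θ = RanB (bindings θ)

VarS : Subst → List Var
VarS θ = Dom θ ++ Ran θ

restrict : Subst → Expr → List Binding
restrict θ u = filter (λ b → proj₁ b ∈? vars u) (bindings θ)

Var₂ : Expr → Expr → List Var
Var₂ s t = vars s ++ vars t

_⊆_ : List Var → List Var → Set
xs ⊆ ys = ∀ {x} → x ∈ xs → x ∈ ys

VarDisjoint : Expr → Expr → Set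
VarDisjoint s t = ∀ {x} → x ∈ vars s → x ∉ vars t

Unifier : Subst → Expr → Expr → Set
Unifier θ s t = s · θ ≡ t · θ

Unifiable : Expr → Expr → Set
Unifiable s t = ∃ λ σ → Unifier σ s t

MoreGeneral : Subst → Subst → Set
MoreGeneral θ σ = ∃ λ δ → ∀ (x : Var) → var x · σ ≡ (var x · θ) · δ

MGU : Subst → Expr → Expr → Set
MGU θ s t = Unifier θ s t × (∀ σ → Unifier σ s t → MoreGeneral θ σ)

RelevantMGU : Subst → Expr → Expr → Set
RelevantMGU θ s t = MGU θ s t × (VarS θ ⊆ Var₂ s t)

VarSet : Set₁
VarSet = Var → Set

LinearFor : Subst → VarSet → Set
LinearFor θ S =
  (∀ x → S x → Linear (var x · θ)) ×
  (∀ x y → S x → S y → x ≢ y → LinearPair (var x · θ) (var y · θ))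

-- Run the standard unification algorithm, composing the mgus of the argument pairs
-- from left to right, on substitutions viewed as functions Var → Term.  Since t is
-- linear and disjoint from s, the mgu ρ₁ of the first argument pair does not touch the
-- remaining arguments ts of t, so the rest of the problem, (ss ρ₁, ts), again has a
-- linear right-hand side disjoint from its left-hand side.  Induction therefore
-- carries the invariant: ρ is a relevant mgu, linear for S, and sends every variable
-- of the left side to itself or to a term over the variables of the right side.  For
-- the recursive call S is replaced by the variables occurring in ρ₁(S), which still
-- avoid ts; linearity of ρ₂ on these is exactly what makes ρ₂ ⊙ ρ₁ linear for S.
-- Finally the finite substitution lists the variables of Var(s, t) moved by ρ.

{-# OPTIONS --safe #-}
module Submission where

open import Defs
open import Data.Nat using (_≟_)
open import Data.Empty using (⊥-elim)
open import Data.List using (List; []; _∷_; _++_; map; concatMap; filter; deduplicate)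
open import Data.List.Properties using (∷-injectiveˡ; ∷-injectiveʳ; concatMap-++; ++-identityʳ; map-id; map-∘)
open import Data.List.Membership.Propositional using (_∈_; _∉_; find)
open import Data.List.Membership.Propositional.Properties
  using (∈-++⁺ˡ; ∈-++⁺ʳ; ∈-++⁻; ∈-concatMap⁻; ∈-map⁻; ∈-filter⁺; ∈-filter⁻; ∈-deduplicate⁺; ∈-deduplicate⁻)
open import Data.List.Membership.DecPropositional _≟_ using (_∈?_)
open import Data.List.Relation.Binary.Disjoint.Propositional using (Disjoint)
open import Data.List.Relation.Unary.All as All using (All; [])
import Data.List.Relation.Unary.All.Properties as Allₚ
open import Data.List.Relation.Unary.Any using (here; there)
open import Data.List.Relation.Unary.Unique.Propositional using (Unique; []; _∷_)
import Data.List.Relation.Unary.Unique.Propositional.Properties as Unique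
import Data.List.Relation.Binary.Subset.Propositional.Properties as Subset
open import Data.List.Relation.Unary.Unique.DecPropositional.Properties _≟_ using (deduplicate-!)
open import Data.Product using (_×_; _,_; proj₁; proj₂; Σ; ∃)
open import Data.Sum using (_⊎_; inj₁; inj₂; [_,_])
open import Function using (_∘_)
open import Relation.Binary.PropositionalEquality
  using (_≡_; _≢_; refl; sym; trans; cong; cong₂; subst; subst₂; _≗_; module ≡-Reasoning)
open import Relation.Nullary using (Dec; yes; no; ¬?)

∈-concatMap⁻′ : ∀ {A B : Set} (f : A → List B) xs {z} → z ∈ concatMap f xs → Σ A λ x → x ∈ xs × z ∈ f x
∈-concatMap⁻′ f xs {z} z∈ = find {P = λ x → z ∈ f x} (∈-concatMap⁻ f {xs = xs} z∈)

Unique-++⁻ : ∀ {A : Set} (xs : List A) {ys} → Unique (xs ++ ys) → Unique xs × Unique ys × Disjoint xs ys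
Unique-++⁻ []       ys! = [] , ys! , λ ()
Unique-++⁻ (x ∷ xs) (x∉ ∷ xsys!) with Unique-++⁻ xs xsys!
... | xs! , ys! , xs#ys =
  Allₚ.++⁻ˡ xs x∉ ∷ xs! , ys! , λ where
    (here refl , v∈ys) → All.lookup (Allₚ.++⁻ʳ xs x∉) v∈ys refl
    (there v∈xs , v∈ys) → xs#ys (v∈xs , v∈ys)

Unique-concatMap⁺ : ∀ {A B : Set} (f : A → List B) {xs} → Unique xs →
  (∀ {x} → x ∈ xs → Unique (f x)) →
  (∀ {x y} → x ∈ xs → y ∈ xs → x ≢ y → Disjoint (f x) (f y)) →
  Unique (concatMap f xs)
Unique-concatMap⁺ f []             _         _ = []
Unique-concatMap⁺ f {x ∷ xs} (x∉xs ∷ xs!) f-lin f-dis =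
  Unique.++⁺ (f-lin (here refl))
             (Unique-concatMap⁺ f xs! (f-lin ∘ there) (λ p q → f-dis (there p) (there q)))
             separated
  where
  separated : Disjoint (f x) (concatMap f xs)
  separated (v∈fx , v∈rest) with ∈-concatMap⁻′ f xs v∈rest
  ... | y , y∈xs , v∈fy = f-dis (here refl) (there y∈xs) (All.lookup x∉xs y∈xs) (v∈fx , v∈fy)

Sub : Set
Sub = Var → Term

mutual
  sub : Sub → Term → Term
  sub ρ (var x)   = ρ x
  sub ρ (fn f ts) = fn f (subL ρ ts)

  subL : Sub → List Term → List Term
  subL ρ []       = []
  subL ρ (t ∷ ts) = sub ρ t ∷ subL ρ ts

infixr 9 _⊙_
_⊙_ : Sub → Sub → Sub
(δ ⊙ ρ) x = sub δ (ρ x)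

mutual
  sub-cong : ∀ {ρ ρ′} u → (∀ x → x ∈ vars u → ρ x ≡ ρ′ x) → sub ρ u ≡ sub ρ′ u
  sub-cong (var x)   eq = eq x (here refl)
  sub-cong (fn f ts) eq = cong (fn f) (subL-cong ts eq)

  subL-cong : ∀ {ρ ρ′} us → (∀ x → x ∈ varsL us → ρ x ≡ ρ′ x) → subL ρ us ≡ subL ρ′ us
  subL-cong []       eq = refl
  subL-cong (u ∷ us) eq =
    cong₂ _∷_ (sub-cong u (λ x → eq x ∘ ∈-++⁺ˡ)) (subL-cong us (λ x → eq x ∘ ∈-++⁺ʳ (vars u)))

mutual
  sub-var : ∀ u → sub var u ≡ u
  sub-var (var x)   = refl
  sub-var (fn f ts) = cong (fn f) (subL-var ts)

  subL-var : ∀ us → subL var us ≡ us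
  subL-var []       = refl
  subL-var (u ∷ us) = cong₂ _∷_ (sub-var u) (subL-var us)

mutual
  sub-⊙ : ∀ δ ρ u → sub δ (sub ρ u) ≡ sub (δ ⊙ ρ) u
  sub-⊙ δ ρ (var x)   = refl
  sub-⊙ δ ρ (fn f ts) = cong (fn f) (subL-⊙ δ ρ ts)

  subL-⊙ : ∀ δ ρ us → subL δ (subL ρ us) ≡ subL (δ ⊙ ρ) us
  subL-⊙ δ ρ []       = refl
  subL-⊙ δ ρ (u ∷ us) = cong₂ _∷_ (sub-⊙ δ ρ u) (subL-⊙ δ ρ us)

mutual
  vars-sub : ∀ ρ u → vars (sub ρ u) ≡ concatMap (vars ∘ ρ) (vars u)
  vars-sub ρ (var x)   = sym (++-identityʳ (vars (ρ x)))
  vars-sub ρ (fn f ts) = varsL-sub ρ ts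

  varsL-sub : ∀ ρ us → varsL (subL ρ us) ≡ concatMap (vars ∘ ρ) (varsL us)
  varsL-sub ρ []       = refl
  varsL-sub ρ (u ∷ us) = begin
    vars (sub ρ u) ++ varsL (subL ρ us)
      ≡⟨ cong₂ _++_ (vars-sub ρ u) (varsL-sub ρ us) ⟩
    concatMap (vars ∘ ρ) (vars u) ++ concatMap (vars ∘ ρ) (varsL us)
      ≡⟨ concatMap-++ (vars ∘ ρ) (vars u) (varsL us) ⟨
    concatMap (vars ∘ ρ) (vars u ++ varsL us) ∎
    where open ≡-Reasoning

sub-fixed : ∀ {ρ} u → (∀ x → x ∈ vars u → ρ x ≡ var x) → sub ρ u ≡ u
sub-fixed u eq = trans (sub-cong u eq) (sub-var u)

subL-fixed : ∀ {ρ} us → (∀ x → x ∈ varsL us → ρ x ≡ var x) → subL ρ us ≡ us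
subL-fixed us eq = trans (subL-cong us eq) (subL-var us)

∈-vars-sub⁻ : ∀ ρ u {z} → z ∈ vars (sub ρ u) → Σ Var λ y → y ∈ vars u × z ∈ vars (ρ y)
∈-vars-sub⁻ ρ u m = ∈-concatMap⁻′ (vars ∘ ρ) (vars u) (subst (_ ∈_) (vars-sub ρ u) m)

∈-varsL-sub⁻ : ∀ ρ us {z} → z ∈ varsL (subL ρ us) → Σ Var λ y → y ∈ varsL us × z ∈ vars (ρ y)
∈-varsL-sub⁻ ρ us m = ∈-concatMap⁻′ (vars ∘ ρ) (varsL us) (subst (_ ∈_) (varsL-sub ρ us) m)

Unifies : Term → Term → Sub → Set
Unifies s t ρ = sub ρ s ≡ sub ρ t

UnifiesL : List Term → List Term → Sub → Set
UnifiesL ss ts ρ = subL ρ ss ≡ subL ρ ts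

record IsMGU (P : Sub → Set) (ρ : Sub) : Set where
  field
    unifies     : P ρ
    mostGeneral : ∀ σ → P σ → Σ Sub λ δ → σ ≗ δ ⊙ ρ
open IsMGU

IsMGU-resp-⇔ : ∀ {P Q ρ} → (∀ {σ} → P σ → Q σ) → (∀ {σ} → Q σ → P σ) → IsMGU P ρ → IsMGU Q ρ
IsMGU-resp-⇔ P⇒Q Q⇒P mgu = record
  { unifies = P⇒Q (unifies mgu) ; mostGeneral = λ σ → mostGeneral mgu σ ∘ Q⇒P }

_↦_ : Var → Term → Sub
(x ↦ u) y with y ≟ x
... | yes _ = u
... | no  _ = var y

↦-same : ∀ x u → (x ↦ u) x ≡ u
↦-same x u with x ≟ x
... | yes _  = refl
... | no x≢x = ⊥-elim (x≢x refl)

↦-other : ∀ {x u y} → y ≢ x → (x ↦ u) y ≡ var y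
↦-other {x} {y = y} y≢x with y ≟ x
... | yes y≡x = ⊥-elim (y≢x y≡x)
... | no  _   = refl

↦-fixes : ∀ {x} u v → x ∉ vars v → sub (x ↦ u) v ≡ v
↦-fixes u v x∉v = sub-fixed v (λ y y∈v → ↦-other (λ { refl → x∉v y∈v }))

↦-isMGU : ∀ {x u} → x ∉ vars u → IsMGU (Unifies (var x) u) (x ↦ u)
↦-isMGU {x} {u} x∉u = record
  { unifies     = trans (↦-same x u) (sym (↦-fixes u u x∉u))
  ; mostGeneral = λ σ σx≡σu → σ , factor σ σx≡σu }
  where
  factor : ∀ σ → σ x ≡ sub σ u → σ ≗ σ ⊙ (x ↦ u)
  factor σ σx≡σu y with y ≟ x
  ... | yes refl = σx≡σu
  ... | no  _    = refl

UnifiesL-instance : ∀ {σ δ ρ} ss ts → σ ≗ δ ⊙ ρ → UnifiesL ss ts σ → UnifiesL (subL ρ ss) (subL ρ ts) δ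
UnifiesL-instance {σ} {δ} {ρ} ss ts σ≗δρ σ-unifies = begin
  subL δ (subL ρ ss) ≡⟨ subL-⊙ δ ρ ss ⟩
  subL (δ ⊙ ρ) ss    ≡⟨ subL-cong ss (λ x _ → σ≗δρ x) ⟨
  subL σ ss          ≡⟨ σ-unifies ⟩
  subL σ ts          ≡⟨ subL-cong ts (λ x _ → σ≗δρ x) ⟩
  subL (δ ⊙ ρ) ts    ≡⟨ subL-⊙ δ ρ ts ⟨
  subL δ (subL ρ ts) ∎
  where open ≡-Reasoning

⊙-isMGU : ∀ {s t ss ts ρ₁ ρ₂} → IsMGU (Unifies s t) ρ₁ →
  IsMGU (UnifiesL (subL ρ₁ ss) (subL ρ₁ ts)) ρ₂ → IsMGU (UnifiesL (s ∷ ss) (t ∷ ts)) (ρ₂ ⊙ ρ₁)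
⊙-isMGU {s} {t} {ss} {ts} {ρ₁} {ρ₂} mgu₁ mgu₂ = record
  { unifies     = cong₂ _∷_ unifies-head unifies-tail
  ; mostGeneral = general }
  where
  open ≡-Reasoning
  unifies-head : Unifies s t (ρ₂ ⊙ ρ₁)
  unifies-head = begin
    sub (ρ₂ ⊙ ρ₁) s      ≡⟨ sub-⊙ ρ₂ ρ₁ s ⟨
    sub ρ₂ (sub ρ₁ s)    ≡⟨ cong (sub ρ₂) (unifies mgu₁) ⟩
    sub ρ₂ (sub ρ₁ t)    ≡⟨ sub-⊙ ρ₂ ρ₁ t ⟩
    sub (ρ₂ ⊙ ρ₁) t      ∎
  unifies-tail : UnifiesL ss ts (ρ₂ ⊙ ρ₁)
  unifies-tail = begin
    subL (ρ₂ ⊙ ρ₁) ss    ≡⟨ subL-⊙ ρ₂ ρ₁ ss ⟨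
    subL ρ₂ (subL ρ₁ ss) ≡⟨ unifies mgu₂ ⟩
    subL ρ₂ (subL ρ₁ ts) ≡⟨ subL-⊙ ρ₂ ρ₁ ts ⟩
    subL (ρ₂ ⊙ ρ₁) ts    ∎
  general : ∀ σ → UnifiesL (s ∷ ss) (t ∷ ts) σ → Σ Sub λ δ → σ ≗ δ ⊙ (ρ₂ ⊙ ρ₁)
  general σ σ-unifies with mostGeneral mgu₁ σ (∷-injectiveˡ σ-unifies)
  ... | δ₁ , σ≗δ₁ρ₁ with mostGeneral mgu₂ δ₁ (UnifiesL-instance ss ts σ≗δ₁ρ₁ (∷-injectiveʳ σ-unifies))
  ...   | δ₂ , δ₁≗δ₂ρ₂ = δ₂ , λ x → begin
    σ x                    ≡⟨ σ≗δ₁ρ₁ x ⟩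
    sub δ₁ (ρ₁ x)          ≡⟨ sub-cong (ρ₁ x) (λ y _ → δ₁≗δ₂ρ₂ y) ⟩
    sub (δ₂ ⊙ ρ₂) (ρ₁ x)   ≡⟨ sub-⊙ δ₂ ρ₂ (ρ₁ x) ⟨
    sub δ₂ (sub ρ₂ (ρ₁ x)) ∎

record Relevant (ρ : Sub) (A : List Var) : Set where
  field
    fixes-outside : ∀ {x} → x ∉ A → ρ x ≡ var x
    closed-inside : ∀ {x} → x ∈ A → vars (ρ x) ⊆ A
open Relevant

Relevant-∈-vars : ∀ {ρ A} → Relevant ρ A → ∀ {y z} → z ∈ vars (ρ y) → z ∈ A ⊎ z ≡ y
Relevant-∈-vars {ρ} {A} rel {y} z∈ρy with y ∈? A
... | yes y∈A = inj₁ (closed-inside rel y∈A z∈ρy)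
... | no  y∉A with subst (λ u → _ ∈ vars u) (fixes-outside rel y∉A) z∈ρy
...   | here z≡y = inj₂ z≡y

Relevant-∈-varsL-sub : ∀ {ρ A} → Relevant ρ A → ∀ us {z} → z ∈ varsL (subL ρ us) → z ∈ A ⊎ z ∈ varsL us
Relevant-∈-varsL-sub {ρ} rel us z∈ with ∈-varsL-sub⁻ ρ us z∈
... | y , y∈us , z∈ρy with Relevant-∈-vars rel z∈ρy
...   | inj₁ z∈A  = inj₁ z∈A
...   | inj₂ refl = inj₂ y∈us

Relevant-weaken : ∀ {ρ A B} → Relevant ρ A → A ⊆ B → Relevant ρ B
Relevant-weaken rel A⊆B = record
  { fixes-outside = λ x∉B → fixes-outside rel (x∉B ∘ A⊆B)
  ; closed-inside = λ x∈B z∈ρx → [ A⊆B , (λ { refl → x∈B }) ] (Relevant-∈-vars rel z∈ρx) }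

⊙-relevant : ∀ {ρ₁ ρ₂ A} → Relevant ρ₁ A → Relevant ρ₂ A → Relevant (ρ₂ ⊙ ρ₁) A
⊙-relevant {ρ₁} {ρ₂} {A} rel₁ rel₂ = record
  { fixes-outside = λ x∉A → trans (cong (sub ρ₂) (fixes-outside rel₁ x∉A)) (fixes-outside rel₂ x∉A)
  ; closed-inside = closed }
  where
  closed : ∀ {x} → x ∈ A → vars (sub ρ₂ (ρ₁ x)) ⊆ A
  closed {x} x∈A z∈ with ∈-vars-sub⁻ ρ₂ (ρ₁ x) z∈
  ... | y , y∈ρ₁x , z∈ρ₂y = closed-inside rel₂ (closed-inside rel₁ x∈A y∈ρ₁x) z∈ρ₂y

↦-relevant : ∀ {x u A} → x ∈ A → vars u ⊆ A → Relevant (x ↦ u) A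
↦-relevant {x} {u} {A} x∈A u⊆A = record
  { fixes-outside = λ y∉A → ↦-other (λ { refl → y∉A x∈A })
  ; closed-inside = closed }
  where
  closed : ∀ {y} → y ∈ A → vars ((x ↦ u) y) ⊆ A
  closed {y} y∈A with y ≟ x
  ... | yes _ = u⊆A
  ... | no  _ = λ { (here refl) → y∈A }

record LinearOn (ρ : Sub) (S : VarSet) : Set where
  field
    linear   : ∀ {x} → S x → Unique (vars (ρ x))
    disjoint : ∀ {x y} → S x → S y → x ≢ y → Disjoint (vars (ρ x)) (vars (ρ y))
open LinearOn

OccursIn : Sub → VarSet → VarSet
OccursIn ρ S y = Σ Var λ x → S x × y ∈ vars (ρ x)

⊙-linearOn : ∀ {ρ₁ ρ₂ S} → LinearOn ρ₁ S → LinearOn ρ₂ (OccursIn ρ₁ S) → LinearOn (ρ₂ ⊙ ρ₁) S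
⊙-linearOn {ρ₁} {ρ₂} {S} lin₁ lin₂ = record { linear = linear′ ; disjoint = disjoint′ }
  where
  linear′ : ∀ {x} → S x → Unique (vars (sub ρ₂ (ρ₁ x)))
  linear′ {x} Sx = subst Unique (sym (vars-sub ρ₂ (ρ₁ x)))
    (Unique-concatMap⁺ (vars ∘ ρ₂) (linear lin₁ Sx)
      (λ y∈ → linear lin₂ (x , Sx , y∈))
      (λ y∈ y′∈ → disjoint lin₂ (x , Sx , y∈) (x , Sx , y′∈)))
  disjoint′ : ∀ {x y} → S x → S y → x ≢ y → Disjoint (vars (sub ρ₂ (ρ₁ x))) (vars (sub ρ₂ (ρ₁ y)))
  disjoint′ {x} {y} Sx Sy x≢y (v∈ρx , v∈ρy)
    with ∈-vars-sub⁻ ρ₂ (ρ₁ x) v∈ρx | ∈-vars-sub⁻ ρ₂ (ρ₁ y) v∈ρy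
  ... | x′ , x′∈ρ₁x , v∈ρ₂x′ | y′ , y′∈ρ₁y , v∈ρ₂y′ with x′ ≟ y′
  ...   | yes refl = disjoint lin₁ Sx Sy x≢y (x′∈ρ₁x , y′∈ρ₁y)
  ...   | no x′≢y′ = disjoint lin₂ (x , Sx , x′∈ρ₁x) (y , Sy , y′∈ρ₁y) x′≢y′ (v∈ρ₂x′ , v∈ρ₂y′)

↦-linearOn : ∀ {x u S} → (S x → Unique (vars u) × (∀ {z} → S z → z ∉ vars u)) → LinearOn (x ↦ u) S
↦-linearOn {x} {u} {S} x-ok = record { linear = linear′ ; disjoint = disjoint′ }
  where
  linear′ : ∀ {y} → S y → Unique (vars ((x ↦ u) y))
  linear′ {y} Sy with y ≟ x
  ... | yes refl = proj₁ (x-ok Sy)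
  ... | no  _    = [] ∷ []
  disjoint′ : ∀ {y z} → S y → S z → y ≢ z → Disjoint (vars ((x ↦ u) y)) (vars ((x ↦ u) z))
  disjoint′ {y} {z} Sy Sz y≢z with y ≟ x | z ≟ x
  ... | yes refl | yes refl = ⊥-elim (y≢z refl)
  ... | yes refl | no  _    = λ { (v∈u , here refl) → proj₂ (x-ok Sy) Sz v∈u }
  ... | no  _    | yes refl = λ { (here refl , v∈u) → proj₂ (x-ok Sz) Sy v∈u }
  ... | no  _    | no  _    = λ { (here refl , here refl) → y≢z refl }

FixedOrInto : Sub → List Var → Var → Set
FixedOrInto ρ T x = ρ x ≡ var x ⊎ vars (ρ x) ⊆ T

⊙-fixedOrInto : ∀ {ρ₁ ρ₂} {T₁ T₂ : List Var} {x} → Disjoint T₁ T₂ → (∀ {y} → y ∉ T₂ → FixedOrInto ρ₂ T₂ y) →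
  x ∉ T₂ → FixedOrInto ρ₁ T₁ x → FixedOrInto (ρ₂ ⊙ ρ₁) (T₁ ++ T₂) x
⊙-fixedOrInto {ρ₁} {ρ₂} {T₁} {T₂} {x} T₁#T₂ fix₂ x∉T₂ (inj₁ ρ₁x≡x)
  rewrite ρ₁x≡x with fix₂ x∉T₂
... | inj₁ ρ₂x≡x = inj₁ ρ₂x≡x
... | inj₂ ρ₂x⊆T₂ = inj₂ (∈-++⁺ʳ T₁ ∘ ρ₂x⊆T₂)
⊙-fixedOrInto {ρ₁} {ρ₂} {T₁} {T₂} {x} T₁#T₂ fix₂ x∉T₂ (inj₂ ρ₁x⊆T₁) = inj₂ into
  where
  into : vars (sub ρ₂ (ρ₁ x)) ⊆ (T₁ ++ T₂)
  into z∈ with ∈-vars-sub⁻ ρ₂ (ρ₁ x) z∈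
  ... | y , y∈ρ₁x , z∈ρ₂y with fix₂ (λ y∈T₂ → T₁#T₂ (ρ₁x⊆T₁ y∈ρ₁x , y∈T₂))
  ...   | inj₂ ρ₂y⊆T₂ = ∈-++⁺ʳ T₁ (ρ₂y⊆T₂ z∈ρ₂y)
  ...   | inj₁ ρ₂y≡y with subst (λ u → _ ∈ vars u) ρ₂y≡y z∈ρ₂y
  ...     | here refl = ∈-++⁺ˡ (ρ₁x⊆T₁ y∈ρ₁x)

fn-injective : ∀ {f g ts us} → fn f ts ≡ fn g us → f ≡ g × ts ≡ us
fn-injective refl = refl , refl

record LinearProblem (S : VarSet) (VS VT : List Var) : Set where
  field
    sides-disjoint : Disjoint VS VT
    right-linear   : Unique VT
    S-avoids-right : ∀ {x} → S x → x ∉ VT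

record LinearMGU (S : VarSet) (P : Sub → Set) (VS VT : List Var) (ρ : Sub) : Set where
  field
    isMGU       : IsMGU P ρ
    relevant    : Relevant ρ (VS ++ VT)
    linearOn    : LinearOn ρ S
    fixedOrInto : ∀ {x} → x ∈ VS → FixedOrInto ρ VT x

module _ {S : VarSet} where
  open LinearProblem

  LinearMGU-var-right : ∀ s y → LinearProblem S (vars s) (y ∷ []) →
    LinearMGU S (Unifies s (var y)) (vars s) (y ∷ []) (y ↦ s)
  LinearMGU-var-right s y P = record
    { isMGU       = IsMGU-resp-⇔ sym sym (↦-isMGU (λ y∈s → sides-disjoint P (y∈s , here refl)))
    ; relevant    = ↦-relevant (∈-++⁺ʳ (vars s) (here refl)) ∈-++⁺ˡ
    ; linearOn    = ↦-linearOn (λ Sy → ⊥-elim (S-avoids-right P Sy (here refl)))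
    ; fixedOrInto = λ x∈s → inj₁ (↦-other (λ { refl → sides-disjoint P (x∈s , here refl) })) }

  LinearMGU-var-left : ∀ x t → LinearProblem S (x ∷ []) (vars t) →
    LinearMGU S (Unifies (var x) t) (x ∷ []) (vars t) (x ↦ t)
  LinearMGU-var-left x t P = record
    { isMGU       = ↦-isMGU (λ x∈t → sides-disjoint P (here refl , x∈t))
    ; relevant    = ↦-relevant (here refl) there
    ; linearOn    = ↦-linearOn (λ _ → right-linear P , S-avoids-right P)
    ; fixedOrInto = λ { (here refl) → inj₂ (subst (λ u → _ ∈ vars u) (↦-same x t)) } }

  LinearMGU-fn : ∀ {f ss ts VS VT ρ} → LinearMGU S (UnifiesL ss ts) VS VT ρ →
    LinearMGU S (Unifies (fn f ss) (fn f ts)) VS VT ρ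
  LinearMGU-fn {f} G = record
    { isMGU       = IsMGU-resp-⇔ (cong (fn f)) (proj₂ ∘ fn-injective) isMGU
    ; relevant    = relevant
    ; linearOn    = linearOn
    ; fixedOrInto = fixedOrInto }
    where open LinearMGU G

  LinearMGU-[] : LinearMGU S (UnifiesL [] []) [] [] var
  LinearMGU-[] = record
    { isMGU       = record { unifies = refl ; mostGeneral = λ σ _ → σ , λ _ → refl }
    ; relevant    = record { fixes-outside = λ _ → refl ; closed-inside = λ () }
    ; linearOn    = record { linear = λ _ → [] ∷ [] ; disjoint = λ { _ _ x≢y (here refl , here refl) → x≢y refl } }
    ; fixedOrInto = λ () }

  LinearProblem-head : ∀ s t ss ts → LinearProblem S (vars s ++ varsL ss) (vars t ++ varsL ts) →
    LinearProblem S (vars s) (vars t)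
  LinearProblem-head s t ss ts P = record
    { sides-disjoint = λ (x∈s , x∈t) → sides-disjoint P (∈-++⁺ˡ x∈s , ∈-++⁺ˡ x∈t)
    ; right-linear   = proj₁ (Unique-++⁻ (vars t) (right-linear P))
    ; S-avoids-right = λ Sx x∈t → S-avoids-right P Sx (∈-++⁺ˡ x∈t) }

  module _ (s t : Term) (ss ts : List Term) {ρ₁ : Sub} (P : LinearProblem S (vars s ++ varsL ss) (vars t ++ varsL ts))
           (G₁ : LinearMGU S (Unifies s t) (vars s) (vars t) ρ₁) where
    open LinearMGU G₁ renaming (isMGU to isMGU₁; relevant to relevant₁; linearOn to linearOn₁; fixedOrInto to fixedOrInto₁)

    t#ts : Disjoint (vars t) (varsL ts)
    t#ts = proj₂ (proj₂ (Unique-++⁻ (vars t) (right-linear P)))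

    ts-fresh : ∀ {z} → z ∈ varsL ts → z ∉ vars s ++ vars t
    ts-fresh z∈ts z∈st with ∈-++⁻ (vars s) z∈st
    ... | inj₁ z∈s = sides-disjoint P (∈-++⁺ˡ z∈s , ∈-++⁺ʳ (vars t) z∈ts)
    ... | inj₂ z∈t = t#ts (z∈t , z∈ts)

    ρ₁-fixes-ts : subL ρ₁ ts ≡ ts
    ρ₁-fixes-ts = subL-fixed ts (λ z → fixes-outside relevant₁ ∘ ts-fresh)

    LinearProblem-tail : LinearProblem (OccursIn ρ₁ S) (varsL (subL ρ₁ ss)) (varsL ts)
    LinearProblem-tail = record
      { sides-disjoint = sides-disjoint′
      ; right-linear   = proj₁ (proj₂ (Unique-++⁻ (vars t) (right-linear P)))
      ; S-avoids-right = S-avoids-right′ }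
      where
      sides-disjoint′ : Disjoint (varsL (subL ρ₁ ss)) (varsL ts)
      sides-disjoint′ (z∈ss′ , z∈ts) with Relevant-∈-varsL-sub relevant₁ ss z∈ss′
      ... | inj₁ z∈st = ts-fresh z∈ts z∈st
      ... | inj₂ z∈ss = sides-disjoint P (∈-++⁺ʳ (vars s) z∈ss , ∈-++⁺ʳ (vars t) z∈ts)
      S-avoids-right′ : ∀ {y} → OccursIn ρ₁ S y → y ∉ varsL ts
      S-avoids-right′ (x , Sx , y∈ρ₁x) y∈ts with Relevant-∈-vars relevant₁ y∈ρ₁x
      ... | inj₁ y∈st = ts-fresh y∈ts y∈st
      ... | inj₂ refl = S-avoids-right P Sx (∈-++⁺ʳ (vars t) y∈ts)

    tail-unifiable : Σ Sub (UnifiesL (s ∷ ss) (t ∷ ts)) → Σ Sub (UnifiesL (subL ρ₁ ss) ts)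
    tail-unifiable (σ , σ-unifies) with IsMGU.mostGeneral isMGU₁ σ (∷-injectiveˡ σ-unifies)
    ... | δ , σ≗δρ₁ = δ , subst (λ us → UnifiesL (subL ρ₁ ss) us δ) ρ₁-fixes-ts
                              (UnifiesL-instance ss ts σ≗δρ₁ (∷-injectiveʳ σ-unifies))

    LinearMGU-∷ : ∀ {ρ₂} → LinearMGU (OccursIn ρ₁ S) (UnifiesL (subL ρ₁ ss) ts) (varsL (subL ρ₁ ss)) (varsL ts) ρ₂ →
      LinearMGU S (UnifiesL (s ∷ ss) (t ∷ ts)) (vars s ++ varsL ss) (vars t ++ varsL ts) (ρ₂ ⊙ ρ₁)
    LinearMGU-∷ {ρ₂} G₂ = record
      { isMGU       = ⊙-isMGU {s} {t} {ss} {ts} isMGU₁ (subst (λ us → IsMGU (UnifiesL (subL ρ₁ ss) us) ρ₂) (sym ρ₁-fixes-ts) isMGU₂)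
      ; relevant    = ⊙-relevant (Relevant-weaken relevant₁ head⊆) (Relevant-weaken relevant₂ tail⊆)
      ; linearOn    = ⊙-linearOn {ρ₁} linearOn₁ linearOn₂
      ; fixedOrInto = λ x∈ → ⊙-fixedOrInto {ρ₁} t#ts fix₂ (x∉ts x∈) (fix₁ x∈) }
      where
      open LinearMGU G₂ renaming (isMGU to isMGU₂; relevant to relevant₂; linearOn to linearOn₂; fixedOrInto to fixedOrInto₂)
      A : List Var
      A = (vars s ++ varsL ss) ++ (vars t ++ varsL ts)
      head⊆ : (vars s ++ vars t) ⊆ A
      head⊆ = Subset.++⁺ (Subset.xs⊆xs++ys (vars s) (varsL ss)) (Subset.xs⊆xs++ys (vars t) (varsL ts))
      tail⊆ : (varsL (subL ρ₁ ss) ++ varsL ts) ⊆ A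
      tail⊆ z∈ with ∈-++⁻ (varsL (subL ρ₁ ss)) z∈
      ... | inj₂ z∈ts = ∈-++⁺ʳ (vars s ++ varsL ss) (∈-++⁺ʳ (vars t) z∈ts)
      ... | inj₁ z∈ss′ with Relevant-∈-varsL-sub relevant₁ ss z∈ss′
      ...   | inj₁ z∈st = head⊆ z∈st
      ...   | inj₂ z∈ss = ∈-++⁺ˡ (∈-++⁺ʳ (vars s) z∈ss)
      x∉ts : ∀ {x} → x ∈ vars s ++ varsL ss → x ∉ varsL ts
      x∉ts x∈ x∈ts = sides-disjoint P (x∈ , ∈-++⁺ʳ (vars t) x∈ts)
      fix₁ : ∀ {x} → x ∈ vars s ++ varsL ss → FixedOrInto ρ₁ (vars t) x
      fix₁ {x} x∈ with x ∈? vars s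
      ... | yes x∈s = fixedOrInto₁ x∈s
      ... | no  x∉s = inj₁ (fixes-outside relevant₁
                        ([ x∉s , (λ x∈t → sides-disjoint P (x∈ , ∈-++⁺ˡ x∈t)) ] ∘ ∈-++⁻ (vars s)))
      fix₂ : ∀ {y} → y ∉ varsL ts → FixedOrInto ρ₂ (varsL ts) y
      fix₂ {y} y∉ts with y ∈? varsL (subL ρ₁ ss)
      ... | yes y∈ss′ = fixedOrInto₂ y∈ss′
      ... | no  y∉ss′ = inj₁ (fixes-outside relevant₂ ([ y∉ss′ , y∉ts ] ∘ ∈-++⁻ (varsL (subL ρ₁ ss))))

mutual
  linearMGU : ∀ {S} s t → LinearProblem S (vars s) (vars t) → Σ Sub (Unifies s t) →
    Σ Sub (LinearMGU S (Unifies s t) (vars s) (vars t))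
  linearMGU s         (var y)   P _ = y ↦ s , LinearMGU-var-right s y P
  linearMGU (var x)   (fn g ts) P _ = x ↦ fn g ts , LinearMGU-var-left x (fn g ts) P
  linearMGU (fn f ss) (fn g ts) P (σ , σ-unifies) with fn-injective σ-unifies
  ... | refl , σ-unifiesL with linearMGUL ss ts P (σ , σ-unifiesL)
  ...   | ρ , G = ρ , LinearMGU-fn G

  linearMGUL : ∀ {S} ss ts → LinearProblem S (varsL ss) (varsL ts) → Σ Sub (UnifiesL ss ts) →
    Σ Sub (LinearMGU S (UnifiesL ss ts) (varsL ss) (varsL ts))
  linearMGUL []       []       P _       = var , LinearMGU-[]
  linearMGUL []       (_ ∷ _)  P (_ , ())
  linearMGUL (_ ∷ _)  []       P (_ , ())
  linearMGUL (s ∷ ss) (t ∷ ts) P (σ , σ-unifies)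
    with linearMGU s t (LinearProblem-head s t ss ts P) (σ , ∷-injectiveˡ σ-unifies)
  ... | ρ₁ , G₁ with linearMGUL (subL ρ₁ ss) ts (LinearProblem-tail s t ss ts P G₁)
                                (tail-unifiable s t ss ts P G₁ (σ , σ-unifies))
  ...   | ρ₂ , G₂ = ρ₂ ⊙ ρ₁ , LinearMGU-∷ s t ss ts P G₁ G₂

⟦_⟧ : Subst → Sub
⟦ θ ⟧ = lookupB (bindings θ)

mutual
  applyB-sub : ∀ bs u → applyB bs u ≡ sub (lookupB bs) u
  applyB-sub bs (var x)   = refl
  applyB-sub bs (fn f ts) = cong (fn f) (applyBL-subL bs ts)

  applyBL-subL : ∀ bs us → applyBL bs us ≡ subL (lookupB bs) us
  applyBL-subL bs []       = refl
  applyBL-subL bs (u ∷ us) = cong₂ _∷_ (applyB-sub bs u) (applyBL-subL bs us)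

·-sub : ∀ u θ → u · θ ≡ sub ⟦ θ ⟧ u
·-sub u θ = applyB-sub (bindings θ) u

lookupB-∉-DomB : ∀ bs {x} → x ∉ DomB bs → lookupB bs x ≡ var x
lookupB-∉-DomB []             x∉ = refl
lookupB-∉-DomB ((y , t) ∷ bs) {x} x∉ with x ≟ y
... | yes x≡y = ⊥-elim (x∉ (here x≡y))
... | no  _   = lookupB-∉-DomB bs (x∉ ∘ there)

isVar? : ∀ u x → Dec (u ≡ var x)
isVar? (var y)   x with y ≟ x
... | yes refl = yes refl
... | no  y≢x  = no λ { refl → y≢x refl }
isVar? (fn f ts) x = no λ ()

moved : Sub → List Var → List Var
moved ρ A = filter (λ x → ¬? (isVar? (ρ x) x)) (deduplicate _≟_ A)

graph : Sub → List Var → List Binding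
graph ρ = map (λ x → x , ρ x)

toSubst : Sub → List Var → Subst
toSubst ρ A = mkSubst (graph ρ (moved ρ A)) distinct′ nontrivial
  where
  distinct′ : Unique (map proj₁ (graph ρ (moved ρ A)))
  distinct′ = subst Unique (trans (sym (map-id (moved ρ A))) (map-∘ (moved ρ A)))
                (Unique.filter⁺ (λ x → ¬? (isVar? (ρ x) x)) (deduplicate-! A))
  nontrivial : All (λ b → proj₂ b ≢ var (proj₁ b)) (graph ρ (moved ρ A))
  nontrivial = Allₚ.map⁺ (Allₚ.all-filter (λ x → ¬? (isVar? (ρ x) x)) (deduplicate _≟_ A))

∈-moved⁻ : ∀ {ρ A x} → x ∈ moved ρ A → x ∈ A × ρ x ≢ var x
∈-moved⁻ {ρ} {A} x∈ with ∈-filter⁻ (λ x → ¬? (isVar? (ρ x) x)) {xs = deduplicate _≟_ A} x∈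
... | x∈dedup , moves = ∈-deduplicate⁻ _≟_ A x∈dedup , moves

∉-moved : ∀ {ρ A y} → (∀ {x} → x ∉ A → ρ x ≡ var x) → y ∉ moved ρ A → ρ y ≡ var y
∉-moved {ρ} {A} {y} fixes y∉ with isVar? (ρ y) y | y ∈? A
... | yes ρy≡y | _      = ρy≡y
... | no  _    | no y∉A = fixes y∉A
... | no  ρy≢y | yes y∈A =
  ⊥-elim (y∉ (∈-filter⁺ (λ x → ¬? (isVar? (ρ x) x)) (∈-deduplicate⁺ _≟_ y∈A) ρy≢y))

lookupB-graph : ∀ ρ xs {y} → (y ∉ xs → ρ y ≡ var y) → lookupB (graph ρ xs) y ≡ ρ y
lookupB-graph ρ []       fixes = sym (fixes λ ())
lookupB-graph ρ (x ∷ xs) {y} fixes with y ≟ x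
... | yes refl = refl
... | no  y≢x  = lookupB-graph ρ xs (λ y∉xs → fixes λ { (here y≡x) → y≢x y≡x ; (there y∈xs) → y∉xs y∈xs })

⟦toSubst⟧ : ∀ {ρ A} → (∀ {x} → x ∉ A → ρ x ≡ var x) → ⟦ toSubst ρ A ⟧ ≗ ρ
⟦toSubst⟧ {ρ} {A} fixes y = lookupB-graph ρ (moved ρ A) (∉-moved fixes)

·-toSubst : ∀ {ρ A} → (∀ {x} → x ∉ A → ρ x ≡ var x) → ∀ u → u · toSubst ρ A ≡ sub ρ u
·-toSubst {ρ} {A} fixes u = trans (·-sub u (toSubst ρ A)) (sub-cong u (λ y _ → ⟦toSubst⟧ fixes y))

∈-toSubst⁻ : ∀ {ρ A b} → b ∈ bindings (toSubst ρ A) →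
  proj₁ b ∈ A × proj₂ b ≡ ρ (proj₁ b) × ρ (proj₁ b) ≢ var (proj₁ b)
∈-toSubst⁻ {ρ} {A} b∈ with ∈-map⁻ (λ x → x , ρ x) {xs = moved ρ A} b∈
... | x , x∈ , refl = proj₁ (∈-moved⁻ {ρ} {A} x∈) , refl , proj₂ (∈-moved⁻ {ρ} {A} x∈)

Unifier⇒Unifies : ∀ σ s t → Unifier σ s t → Unifies s t ⟦ σ ⟧
Unifier⇒Unifies σ s t σ-unifies = trans (sym (·-sub s σ)) (trans σ-unifies (·-sub t σ))

toSubst-MGU : ∀ {s t ρ} → IsMGU (Unifies s t) ρ → Relevant ρ (Var₂ s t) → MGU (toSubst ρ (Var₂ s t)) s t
toSubst-MGU {s} {t} {ρ} mgu rel = unifier , general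
  where
  open ≡-Reasoning
  A : List Var
  A = Var₂ s t
  θ : Subst
  θ = toSubst ρ A
  unifier : Unifier θ s t
  unifier = begin
    s · θ   ≡⟨ ·-toSubst (fixes-outside rel) s ⟩
    sub ρ s ≡⟨ unifies mgu ⟩
    sub ρ t ≡⟨ ·-toSubst (fixes-outside rel) t ⟨
    t · θ   ∎
  general : ∀ σ → Unifier σ s t → MoreGeneral θ σ
  general σ σ-unifies with mostGeneral mgu ⟦ σ ⟧ (Unifier⇒Unifies σ s t σ-unifies)
  ... | δ , σ≗δρ = toSubst δ (A ++ Dom σ) , λ x → begin
    ⟦ σ ⟧ x                        ≡⟨ σ≗δρ x ⟩
    sub δ (ρ x)                    ≡⟨ cong (sub δ) (⟦toSubst⟧ (fixes-outside rel) x) ⟨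
    sub δ (var x · θ)              ≡⟨ ·-toSubst δ-fixes (var x · θ) ⟨
    (var x · θ) · toSubst δ (A ++ Dom σ) ∎
    where
    -- δ agrees with ⟦ σ ⟧ off Var(s, t), where ρ is the identity, so it has finite support.
    δ-fixes : ∀ {y} → y ∉ A ++ Dom σ → δ y ≡ var y
    δ-fixes {y} y∉ = begin
      sub δ (var y) ≡⟨ cong (sub δ) (fixes-outside rel (y∉ ∘ ∈-++⁺ˡ)) ⟨
      sub δ (ρ y)   ≡⟨ σ≗δρ y ⟨
      ⟦ σ ⟧ y       ≡⟨ lookupB-∉-DomB (bindings σ) (y∉ ∘ ∈-++⁺ʳ A) ⟩
      var y         ∎

toSubst-VarS : ∀ {ρ A} → Relevant ρ A → VarS (toSubst ρ A) ⊆ A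
toSubst-VarS {ρ} {A} rel z∈ with ∈-++⁻ (Dom (toSubst ρ A)) z∈
... | inj₁ z∈Dom with ∈-map⁻ proj₁ {xs = bindings (toSubst ρ A)} z∈Dom
...   | b , b∈ , refl = proj₁ (∈-toSubst⁻ {ρ} {A} b∈)
toSubst-VarS {ρ} {A} rel z∈ | inj₂ z∈Ran with ∈-concatMap⁻′ (vars ∘ proj₂) (bindings (toSubst ρ A)) z∈Ran
...   | (x , u) , b∈ , z∈u with ∈-toSubst⁻ {ρ} {A} b∈
...     | x∈A , refl , _ = closed-inside rel x∈A z∈u

toSubst-LinearFor : ∀ {ρ A S} → (∀ {x} → x ∉ A → ρ x ≡ var x) → LinearOn ρ S → LinearFor (toSubst ρ A) S
toSubst-LinearFor {ρ} {A} fixes lin =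
  (λ x Sx → subst (Unique ∘ vars) (sym (⟦toSubst⟧ fixes x)) (linear lin Sx)) ,
  (λ x y Sx Sy x≢y → subst₂ (λ u v → Unique (vars u ++ vars v)) (sym (⟦toSubst⟧ fixes x)) (sym (⟦toSubst⟧ fixes y))
                       (Unique.++⁺ (linear lin Sx) (linear lin Sy) (disjoint lin Sx Sy x≢y)))

toSubst-restrict : ∀ {ρ A s T} → (∀ {x} → x ∈ vars s → FixedOrInto ρ T x) → RanB (restrict (toSubst ρ A) s) ⊆ T
toSubst-restrict {ρ} {A} {s} fix z∈ with ∈-concatMap⁻′ (vars ∘ proj₂) (restrict (toSubst ρ A) s) z∈
... | (x , u) , b∈ , z∈u with ∈-filter⁻ (λ b → proj₁ b ∈? vars s) {xs = bindings (toSubst ρ A)} b∈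
...   | b∈θ , x∈s with ∈-toSubst⁻ {ρ} {A} b∈θ | fix x∈s
...     | _ , refl , moves | inj₁ fixed = ⊥-elim (moves fixed)
...     | _ , refl , _     | inj₂ into  = into z∈u

lemma28 : (s t : Expr) (S : VarSet) →
    VarDisjoint s t → Linear t →
    (∀ x → S x → x ∉ vars t) →
    Unifiable s t →
    ∃ λ θ → RelevantMGU θ s t × LinearFor θ S × (RanB (restrict θ s) ⊆ vars t)
lemma28 s t S s#t t-linear S∉t (σ , σ-unifies) =
  toSubst ρ A , (toSubst-MGU {s} {t} isMGU relevant , toSubst-VarS relevant) ,
  toSubst-LinearFor (fixes-outside relevant) linearOn , toSubst-restrict {ρ} {A} {s} fixedOrInto
  where
  problem : LinearProblem S (vars s) (vars t)
  problem = record
    { sides-disjoint = λ (x∈s , x∈t) → s#t x∈s x∈t ; right-linear = t-linear ; S-avoids-right = S∉t _ }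
  A : List Var
  A = Var₂ s t
  solution : Σ Sub (LinearMGU S (Unifies s t) (vars s) (vars t))
  solution = linearMGU s t problem (⟦ σ ⟧ , Unifier⇒Unifies σ s t σ-unifies)
  ρ : Sub
  ρ = proj₁ solution
  open LinearMGU (proj₂ solution)
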